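{- Let $G$ be a graph, $k\ge 1$, with $V(G)=V_1\uplus\cdots\uplus V_k$ where each $V_i$ is an independent set in $G$, let $q$ be a prime power, and let $H$ be the graph constructed from $(G,k,q)$ as described below. If $G$ has no $k$-clique, then $H$ has no clique of size $k\cdot q^{k-1}+1$.
   Context: Construction of $H$: let $n=|V(G)|$ and $d=\lceil \frac{3\log n}{\log q}+3\rceil$, and identify $V(G)$ with a linear Sidon set $S\subseteq\mathbb F_q^d$ of size $n$ (i.e., for all $a,b\in\mathbb F_q^*$ and $x,y,x',y'\in S$ with $x\ne y$, $x'\ne y'$, $ax+by=ax'+by'$ implies $\{x,y\}=\{x',y'\}$). For $r\in\mathbb F_q^k$ let the column $C_r=\{\mathrm{P}_{r,\pi}:\pi\in\mathbb F_q^d\}$ consist of distinct new vertices, and $V(H)=\bigcup_{r\in\mathbb F_q^k} C_r$. For $r\in\mathbb F_q^k$ write $e_i$ for the $i$-th unit vector and $\mathrm{Hamming}(r,r')$ for the number of coordinates where $r,r'$ differ. Edges between $\mathrm{P}_{r,\pi}$ and $\mathrm{P}_{r',\pi'}$: (H1) if $r=r'$, no edge; (H2) if $\mathrm{Hamming}(r,r')=1$, say $r'=r+ae_i$ with $a\in\mathbb F_q^*$, $i\in[k]$, there is an edge iff $\pi'-\pi=av$ for some $v\in V_i$; (H3) if $\mathrm{Hamming}(r,r')=2$, say $r'=r+ae_i+be_j$ with $a,b\in\mathbb F_q^*$ and distinct $i,j\in[k]$, there is an edge iff $\pi'-\pi=au+bv$ for some $u\in V_i$, $v\in V_j$ with $uv\in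 E(G)$; (H4) if $\mathrm{Hamming}(r,r')\ge 3$, there is an edge. -}

module Defs where

open import Level using (0ℓ)
open import Data.Nat using (ℕ; _+_; _*_; _∸_; _^_; _≤_)
open import Data.Fin using (Fin)
open import Data.Product using (Σ; ∃; ∃-syntax; _×_; _,_)
open import Data.Sum using (_⊎_)
open import Data.List using (length; filter)
open import Data.List.Base using ()
open import Data.Fin.Base using ()
open import Data.List using (List)
open import Data.Fin.Properties using ()
open import Relation.Nullary using (¬_)
open import Relation.Nullary.Decidable using (¬?)
open import Relation.Binary.PropositionalEquality using (_≡_; _≢_)
open import Relation.Binary.Definitions using (DecidableEquality)
open import Algebra.Structures using (IsCommutativeRing)
open import Function.Bundles using (_↔_)
open import Data.Nat.Primality using (Prime)
import Data.List as L
open import Data.List using (allFin)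

record FiniteField (q : ℕ) : Set₁ where
  field
    Carrier : Set
    _+F_ _*F_ : Carrier → Carrier → Carrier
    -F_     : Carrier → Carrier
    0# 1#   : Carrier
    isCommutativeRing : IsCommutativeRing _≡_ _+F_ _*F_ -F_ 0# 1#
    0≢1     : 0# ≢ 1#
    inverse : ∀ x → x ≢ 0# → ∃[ y ] (x *F y ≡ 1#)
    _≟_     : DecidableEquality Carrier
    enum    : Fin q ↔ Carrier

IsPrimePower : ℕ → Set
IsPrimePower q = ∃[ p ] ∃[ m ] (Prime p × 1 ≤ m × q ≡ p ^ m)

record Graph (n : ℕ) : Set₁ where
  field
    Adj   : Fin n → Fin n → Set
    sym   : ∀ {u v} → Adj u v → Adj v u
    irrefl : ∀ {u} → ¬ Adj u u

IsClique : {V : Set} → (V → V → Set) → (s : ℕ) → (Fin s → V) → Set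
IsClique Adj s c = ∀ i j → i ≢ j → Adj (c i) (c j)

HasClique : {V : Set} → (V → V → Set) → ℕ → Set
HasClique {V} Adj s = Σ (Fin s → V) (IsClique Adj s)

-- A partition V(G) = V_1 ⊎ ... ⊎ V_k into independent sets:
-- part v = i means v ∈ V_i.
IsIndependentPartition : {n : ℕ} → Graph n → (k : ℕ) → (Fin n → Fin k) → Set
IsIndependentPartition G k part = ∀ u v → Graph.Adj G u v → part u ≢ part v

-- d = ⌈ 3 log n / log q + 3 ⌉, i.e. d = 3 + (least m with n^3 ≤ q^m).
IsDimension : (n q d : ℕ) → Set
IsDimension n q d =
  3 ≤ d × n ^ 3 ≤ q ^ (d ∸ 3) × (∀ m → n ^ 3 ≤ q ^ m → d ∸ 3 ≤ m)

module Construction {q : ℕ} (F : FiniteField q) where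
  open FiniteField F

  Vec' : ℕ → Set
  Vec' d = Fin d → Carrier

  _⊕_ : ∀ {d} → Vec' d → Vec' d → Vec' d
  (x ⊕ y) i = x i +F y i

  _·_ : ∀ {d} → Carrier → Vec' d → Vec' d
  (a · x) i = a *F x i

  _⊖_ : ∀ {d} → Vec' d → Vec' d → Vec' d
  (x ⊖ y) i = x i +F (-F (y i))

  _≋_ : ∀ {d} → Vec' d → Vec' d → Set
  x ≋ y = ∀ i → x i ≡ y i

  e : ∀ {k} → Fin k → Vec' k
  e i j with i Data.Fin.≟ j
  ... | Relation.Nullary.yes _ = 1#
  ... | Relation.Nullary.no _ = 0#

  hamming : ∀ {k} → Vec' k → Vec' k → ℕ
  hamming {k} r r' = length (filter (λ i → ¬? (r i ≟ r' i)) (allFin k))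

  IsLinearSidon : ∀ {n d} → (Fin n → Vec' d) → Set
  IsLinearSidon {n} φ =
    (∀ u v → φ u ≋ φ v → u ≡ v) ×
    (∀ (a b : Carrier) → a ≢ 0# → b ≢ 0# →
     ∀ (x y x' y' : Fin n) → x ≢ y → x' ≢ y' →
     ((a · φ x) ⊕ (b · φ y)) ≋ ((a · φ x') ⊕ (b · φ y')) →
     (x ≡ x' × y ≡ y') ⊎ (x ≡ y' × y ≡ x'))

  -- The graph H; vertex P_{r,π} is the pair (r , π).
  module H {n : ℕ} (G : Graph n) (k : ℕ) (part : Fin n → Fin k)
           (d : ℕ) (φ : Fin n → Vec' d) where
    open Graph G

    VH : Set
    VH = Vec' k × Vec' d

    H2 : VH → VH → Set
    H2 (r , π) (r' , π') =
      ∃[ i ] ∃[ a ] (a ≢ 0# × r' ≋ (r ⊕ (a · e i)) ×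
        ∃[ v ] (part v ≡ i × (π' ⊖ π) ≋ (a · φ v)))

    H3 : VH → VH → Set
    H3 (r , π) (r' , π') =
      ∃[ i ] ∃[ j ] ∃[ a ] ∃[ b ] (i ≢ j × a ≢ 0# × b ≢ 0# ×
        r' ≋ ((r ⊕ (a · e i)) ⊕ (b · e j)) ×
        ∃[ u ] ∃[ v ] (part u ≡ i × part v ≡ j × Adj u v ×
          (π' ⊖ π) ≋ ((a · φ u) ⊕ (b · φ v))))

    -- (H4): Hamming distance ≥ 3.  (H1): no edge when r = r' (no clause).
    H4 : VH → VH → Set
    H4 (r , π) (r' , π') = 3 ≤ hamming r r'

    AdjH : VH → VH → Set
    AdjH x y = H2 x y ⊎ H3 x y ⊎ H4 x y

-- Let C be a clique of H. If some vertex x = P_{r,π} of C has, for every direction i, a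
-- neighbour y_i in C whose row differs from r only in coordinate i, then the edges x y_i are
-- of type (H2) and yield vertices v_i ∈ V_i with π_{y_i} − π = a_i v_i. For i ≠ j the edge
-- y_i y_j must be of type (H3) along {i, j}, which gives −a_i u + a_j v = −a_i v_i + a_j v_j
-- for some edge uv of G with u ∈ V_i, v ∈ V_j; the Sidon property forces {u, v} = {v_i, v_j},
-- so v_1, …, v_k is a k-clique of G. Otherwise every vertex x of C has a direction i_x without
-- such a neighbour, and x ↦ (i_x, r_x with coordinate i_x deleted) takes at most k q^(k−1)
-- values; two vertices with the same value would be adjacent yet differ only in coordinate
-- i_x, i.e. neighbours of the excluded kind.
module Submission where

open import Defs
open import Data.Nat using (ℕ; _+_; _*_; _∸_; _^_; _≤_)
open import Data.Fin using (Fin)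
open import Relation.Nullary using (¬_)

open import Level using (0ℓ)
open import Data.Nat using (suc; _<_; s≤s; z≤n; z<s)
open import Data.Nat.Properties using (≮⇒≥; <⇒≱; m<m+n)
open import Data.Fin using (combine; funToFin; finToFun; punchIn; punchOut) renaming (_<_ to _<ᶠ_)
open import Data.Fin.Properties
  using (pigeonhole; combine-injective; finToFun-funToFin; punchIn-punchOut; <⇒≢; any?; all?; ¬∀⟶∃¬)
  renaming (_≟_ to _≟ᶠ_)
open import Data.Product using (∃; ∃₂; _×_; _,_; proj₁; proj₂)
open import Data.Sum using (_⊎_; inj₁; inj₂; reduce)
open import Data.Empty using (⊥; ⊥-elim)
open import Data.List using (List; []; _∷_; length; filter; allFin)
open import Data.List.Relation.Unary.All using (All; []; _∷_)
import Data.List.Relation.Unary.All as All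
open import Data.List.Relation.Unary.All.Properties using (all-filter)
open import Data.List.Relation.Unary.AllPairs using (_∷_)
open import Data.List.Relation.Unary.Unique.Propositional using (Unique)
open import Data.List.Relation.Unary.Unique.Propositional.Properties using (filter⁺; allFin⁺)
open import Relation.Nullary using (Dec; yes; no; contradiction)
open import Relation.Nullary.Decidable using (¬?; _×-dec_; _→-dec_)
open import Relation.Binary.Definitions using (DecidableEquality)
open import Relation.Binary.PropositionalEquality
  using (_≡_; _≢_; refl; sym; trans; cong; cong₂; subst; subst₂; module ≡-Reasoning)
open import Function.Bundles using (_↣_; Injection)
open import Function.Properties.Inverse using (↔-sym; ↔⇒↣)
open import Algebra.Bundles using (CommutativeRing)
import Algebra.Properties.AbelianGroup as AbelianGroupProperties
import Algebra.Properties.Ring as RingProperties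

unique-within-pair⇒length≤2 : {A : Set} {i j : A} {xs : List A} →
  Unique xs → All (λ m → m ≡ i ⊎ m ≡ j) xs → length xs ≤ 2
unique-within-pair⇒length≤2 {xs = []} _ _ = z≤n
unique-within-pair⇒length≤2 {xs = _ ∷ []} _ _ = s≤s z≤n
unique-within-pair⇒length≤2 {xs = _ ∷ _ ∷ []} _ _ = s≤s (s≤s z≤n)
unique-within-pair⇒length≤2 {xs = _ ∷ _ ∷ _ ∷ _}
  ((a≢b ∷ a≢c ∷ _) ∷ (b≢c ∷ _) ∷ _) (a∈ ∷ b∈ ∷ c∈ ∷ _) =
  ⊥-elim (three-distinct a≢b a≢c b≢c a∈ b∈ c∈)
  where
  three-distinct : {A : Set} {i j a b c : A} → a ≢ b → a ≢ c → b ≢ c →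
    a ≡ i ⊎ a ≡ j → b ≡ i ⊎ b ≡ j → c ≡ i ⊎ c ≡ j → ⊥
  three-distinct a≢b _ _ (inj₁ refl) (inj₁ refl) _ = a≢b refl
  three-distinct a≢b _ _ (inj₂ refl) (inj₂ refl) _ = a≢b refl
  three-distinct _ a≢c _ (inj₁ refl) _ (inj₁ refl) = a≢c refl
  three-distinct _ a≢c _ (inj₂ refl) _ (inj₂ refl) = a≢c refl
  three-distinct _ _ b≢c _ (inj₁ refl) (inj₁ refl) = b≢c refl
  three-distinct _ _ b≢c _ (inj₂ refl) (inj₂ refl) = b≢c refl

module _ {A : Set} {k : ℕ} where

  AgreeOutside : (Fin k → A) → (Fin k → A) → Fin k → Fin k → Set
  AgreeOutside r r' i j = ∀ m → m ≢ i → m ≢ j → r m ≡ r' m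

  DifferOnlyAt : Fin k → (Fin k → A) → (Fin k → A) → Set
  DifferOnlyAt i r r' = AgreeOutside r r' i i × r i ≢ r' i

  differOnlyAt? : DecidableEquality A → ∀ i r r' → Dec (DifferOnlyAt i r r')
  differOnlyAt? _≟_ i r r' =
    all? (λ m → ¬? (m ≟ᶠ i) →-dec (¬? (m ≟ᶠ i) →-dec (r m ≟ r' m))) ×-dec ¬? (r i ≟ r' i)

  disagreement-within : ∀ {r r' i j m} → AgreeOutside r r' i j → r m ≢ r' m → m ≡ i ⊎ m ≡ j
  disagreement-within {i = i} {j} {m} agree r≢r' with m ≟ᶠ i | m ≟ᶠ j
  ... | yes m≡i | _       = inj₁ m≡i
  ... | no _    | yes m≡j = inj₂ m≡j
  ... | no m≢i  | no m≢j  = contradiction (agree m m≢i m≢j) r≢r'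

-- Codes x ↦ (dir x , row x with coordinate dir x deleted) take at most (suc k) · q^k values.
punctured-pigeonhole : ∀ {A : Set} {q k N} → A ↣ Fin q →
  (row : Fin N → Fin (suc k) → A) (dir : Fin N → Fin (suc k)) → suc k * q ^ k < N →
  ∃₂ λ x y → x ≢ y × AgreeOutside (row x) (row y) (dir x) (dir x)
punctured-pigeonhole {A} {q} {k} {N} ι row dir lt = collide (pigeonhole lt code)
  where
  open Injection ι using (to; injective)
  punctured : Fin N → Fin (suc k) → Fin k → Fin q
  punctured z i t = to (row z (punchIn i t))
  code : Fin N → Fin (suc k * q ^ k)
  code z = combine (dir z) (funToFin (punctured z (dir z)))
  agree-if-same-code : ∀ {x y} → dir x ≡ dir y →
    funToFin (punctured x (dir x)) ≡ funToFin (punctured y (dir y)) →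
    AgreeOutside (row x) (row y) (dir x) (dir x)
  agree-if-same-code {x} {y} same-dir same-rest m m≢i _ =
    subst (λ m → row x m ≡ row y m) (punchIn-punchOut i≢m) (injective same-punctured)
    where
    i≢m : dir x ≢ m
    i≢m i≡m = m≢i (sym i≡m)
    t : Fin k
    t = punchOut i≢m
    same-punctured : punctured x (dir x) t ≡ punctured y (dir x) t
    same-punctured = begin
      punctured x (dir x) t                       ≡⟨ sym (finToFun-funToFin (punctured x (dir x)) t) ⟩
      finToFun (funToFin (punctured x (dir x))) t ≡⟨ cong (λ c → finToFun c t) same-rest ⟩
      finToFun (funToFin (punctured y (dir y))) t ≡⟨ finToFun-funToFin (punctured y (dir y)) t ⟩
      punctured y (dir y) t                       ≡⟨ cong (λ i → punctured y i t) (sym same-dir) ⟩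
      punctured y (dir x) t                       ∎
      where open ≡-Reasoning
  collide : (∃₂ λ x y → x <ᶠ y × code x ≡ code y) →
    ∃₂ λ x y → x ≢ y × AgreeOutside (row x) (row y) (dir x) (dir x)
  collide (x , y , x<y , same-code) with combine-injective (dir x) _ (dir y) _ same-code
  ... | same-dir , same-rest = x , y , <⇒≢ x<y , agree-if-same-code same-dir same-rest

module FieldFacts {q : ℕ} (F : FiniteField q) where
  open FiniteField F
  open Construction F

  ring : CommutativeRing 0ℓ 0ℓ
  ring = record { isCommutativeRing = isCommutativeRing }

  open CommutativeRing ring using (+-assoc; +-identityˡ; +-identityʳ; -‿inverseˡ; *-identityʳ; zeroʳ)
  open AbelianGroupProperties (CommutativeRing.+-abelianGroup ring)
    using (∙-cancelˡ; inverseʳ-unique; ⁻¹-anti-homo-∙; ⁻¹-involutive)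

  x+a≢x : ∀ {x a} → a ≢ 0# → x +F a ≢ x
  x+a≢x {x} {a} a≢0 x+a≡x = a≢0 (∙-cancelˡ x a 0# (trans x+a≡x (sym (+-identityʳ x))))

  x≡[x+a]+b⇒b≡-a : ∀ {x a b} → x ≡ (x +F a) +F b → b ≡ -F a
  x≡[x+a]+b⇒b≡-a {x} {a} {b} eq = inverseʳ-unique a b
    (∙-cancelˡ x (a +F b) 0# (trans (sym (+-assoc x a b)) (trans (sym eq) (sym (+-identityʳ x)))))

  [z-x]-[y-x]≡z-y : ∀ x y z → (z +F (-F x)) +F (-F (y +F (-F x))) ≡ z +F (-F y)
  [z-x]-[y-x]≡z-y x y z = begin
    (z +F (-F x)) +F (-F (y +F (-F x)))
      ≡⟨ cong ((z +F (-F x)) +F_) (⁻¹-anti-homo-∙ y (-F x)) ⟩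
    (z +F (-F x)) +F ((-F (-F x)) +F (-F y))
      ≡⟨ cong (λ w → (z +F (-F x)) +F (w +F (-F y))) (⁻¹-involutive x) ⟩
    (z +F (-F x)) +F (x +F (-F y))
      ≡⟨ +-assoc z (-F x) (x +F (-F y)) ⟩
    z +F ((-F x) +F (x +F (-F y)))
      ≡⟨ cong (z +F_) (sym (+-assoc (-F x) x (-F y))) ⟩
    z +F (((-F x) +F x) +F (-F y))
      ≡⟨ cong (λ w → z +F (w +F (-F y))) (-‿inverseˡ x) ⟩
    z +F (0# +F (-F y))
      ≡⟨ cong (z +F_) (+-identityˡ (-F y)) ⟩
    z +F (-F y)
      ∎
    where open ≡-Reasoning

  add-unit-same : ∀ {k} (r : Vec' k) a i → (r ⊕ (a · e i)) i ≡ r i +F a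
  add-unit-same r a i with i ≟ᶠ i
  ... | yes _  = cong (r i +F_) (*-identityʳ a)
  ... | no i≢i = contradiction refl i≢i

  add-unit-other : ∀ {k} (r : Vec' k) a {i m} → i ≢ m → (r ⊕ (a · e i)) m ≡ r m
  add-unit-other r a {i} {m} i≢m with i ≟ᶠ m
  ... | yes i≡m = contradiction i≡m i≢m
  ... | no _    = trans (cong (r m +F_) (zeroʳ a)) (+-identityʳ (r m))

  moved-within : ∀ {k} {r r' : Vec' k} {i j m a} →
    AgreeOutside r r' i j → r' m ≡ r m +F a → a ≢ 0# → m ≡ i ⊎ m ≡ j
  moved-within agree r'm a≢0 =
    disagreement-within agree λ r≡r' → x+a≢x a≢0 (trans (sym r'm) (sym r≡r'))

  hamming≥3⇒¬agree-outside-pair : ∀ {k} {r r' : Vec' k} {i j} →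
    3 ≤ hamming r r' → ¬ AgreeOutside r r' i j
  hamming≥3⇒¬agree-outside-pair {k} {r} {r'} 3≤h agree = <⇒≱ 3≤h
    (unique-within-pair⇒length≤2 (filter⁺ differ? (allFin⁺ k))
      (All.map (disagreement-within agree) (all-filter differ? (allFin k))))
    where
    differ? : ∀ m → Dec (r m ≢ r' m)
    differ? m = ¬? (r m ≟ r' m)

module EdgeFacts {q : ℕ} (F : FiniteField q) {n : ℕ} (G : Graph n) (k : ℕ)
                 (part : Fin n → Fin k) (d : ℕ) (φ : Fin n → Construction.Vec' F d) where
  open FiniteField F
  open Construction F
  open H G k part d φ
  open FieldFacts F
  open Graph G renaming (sym to Adj-sym)
  open CommutativeRing ring using (+-comm)
  open RingProperties (CommutativeRing.ring ring) using (-‿distribˡ-*)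
  open AbelianGroupProperties (CommutativeRing.+-abelianGroup ring) using (∙-cancelˡ)

  record AxisEdge (i : Fin k) (r : Vec' k) (π : Vec' d) (r' : Vec' k) (π' : Vec' d) : Set where
    field
      a        : Carrier
      a≢0      : a ≢ 0#
      v        : Fin n
      part-v   : part v ≡ i
      row-step : r' i ≡ r i +F a
      offset   : (π' ⊖ π) ≋ (a · φ v)

  record DiagonalEdge (i j : Fin k) (r : Vec' k) (π : Vec' d) (r' : Vec' k) (π' : Vec' d) : Set where
    field
      a b      : Carrier
      a≢0      : a ≢ 0#
      b≢0      : b ≢ 0#
      u v      : Fin n
      part-u   : part u ≡ i
      part-v   : part v ≡ j
      adjacent : Adj u v
      row-i    : r' i ≡ r i +F a
      row-j    : r' j ≡ r j +F b
      offset   : (π' ⊖ π) ≋ ((a · φ u) ⊕ (b · φ v))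

  H3-row-i : ∀ {r r' : Vec' k} {a b i j} → i ≢ j →
    r' ≋ ((r ⊕ (a · e i)) ⊕ (b · e j)) → r' i ≡ r i +F a
  H3-row-i {r} {a = a} {b} {i} i≢j hr =
    trans (hr i) (trans (add-unit-other (r ⊕ (a · e i)) b (λ j≡i → i≢j (sym j≡i)))
                        (add-unit-same r a i))

  H3-row-j : ∀ {r r' : Vec' k} {a b i j} → i ≢ j →
    r' ≋ ((r ⊕ (a · e i)) ⊕ (b · e j)) → r' j ≡ r j +F b
  H3-row-j {r} {a = a} {b} {i} {j} i≢j hr =
    trans (hr j) (trans (add-unit-same (r ⊕ (a · e i)) b j) (cong (_+F b) (add-unit-other r a i≢j)))

  edge-along : ∀ {i r π r' π'} → AdjH (r , π) (r' , π') → AgreeOutside r r' i i → AxisEdge i r π r' π'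
  edge-along {i} {r} (inj₁ (l , a , a≢0 , hr , v , part-v , offset)) agree
    with reduce (moved-within agree (trans (hr l) (add-unit-same r a l)) a≢0)
  ... | refl = record { a = a ; a≢0 = a≢0 ; v = v ; part-v = part-v
                      ; row-step = trans (hr i) (add-unit-same r a i) ; offset = offset }
  edge-along (inj₂ (inj₁ (i' , j' , a , b , i'≢j' , a≢0 , b≢0 , hr , _))) agree
    with reduce (moved-within agree (H3-row-i i'≢j' hr) a≢0)
       | reduce (moved-within agree (H3-row-j i'≢j' hr) b≢0)
  ... | refl | refl = contradiction refl i'≢j'
  edge-along (inj₂ (inj₂ far)) agree = contradiction agree (hamming≥3⇒¬agree-outside-pair far)

  edge-across : ∀ {i j r π r' π'} → i ≢ j → AdjH (r , π) (r' , π') →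
    AgreeOutside r r' i j → r i ≢ r' i → r j ≢ r' j → DiagonalEdge i j r π r' π'
  edge-across {i} {j} {r} i≢j (inj₁ (l , a , _ , hr , _)) _ r≢r'-i r≢r'-j with l ≟ᶠ i
  ... | yes refl = contradiction (sym (trans (hr j) (add-unit-other r a i≢j))) r≢r'-j
  ... | no l≢i   = contradiction (sym (trans (hr i) (add-unit-other r a l≢i))) r≢r'-i
  edge-across _ (inj₂ (inj₂ far)) agree _ _ = contradiction agree (hamming≥3⇒¬agree-outside-pair far)
  edge-across _ (inj₂ (inj₁ (i' , j' , a , b , i'≢j' , a≢0 , b≢0 , hr , u , v , pu , pv , adj , offset)))
    agree _ _
    with moved-within agree (H3-row-i i'≢j' hr) a≢0 | moved-within agree (H3-row-j i'≢j' hr) b≢0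
  ... | inj₁ refl | inj₁ refl = contradiction refl i'≢j'
  ... | inj₂ refl | inj₂ refl = contradiction refl i'≢j'
  ... | inj₁ refl | inj₂ refl = record
    { a = a ; b = b ; a≢0 = a≢0 ; b≢0 = b≢0 ; u = u ; v = v ; part-u = pu ; part-v = pv
    ; adjacent = adj ; row-i = H3-row-i i'≢j' hr ; row-j = H3-row-j i'≢j' hr ; offset = offset }
  ... | inj₂ refl | inj₁ refl = record
    { a = b ; b = a ; a≢0 = b≢0 ; b≢0 = a≢0 ; u = v ; v = u ; part-u = pv ; part-v = pu
    ; adjacent = Adj-sym adj ; row-i = H3-row-j i'≢j' hr ; row-j = H3-row-i i'≢j' hr
    ; offset = λ m → trans (offset m) (+-comm _ _) }

  sidon-adjacent : IsLinearSidon φ → ∀ {a b u v u' v'} → a ≢ 0# → b ≢ 0# →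
    Adj u v → u' ≢ v' → part u ≢ part v' →
    ((a · φ u) ⊕ (b · φ v)) ≋ ((a · φ u') ⊕ (b · φ v')) → Adj u' v'
  sidon-adjacent (_ , sidon) {a} {b} {u} {v} {u'} {v'} a≢0 b≢0 adj u'≢v' parts-differ same
    with sidon a b a≢0 b≢0 u v u' v' (λ u≡v → irrefl (subst (Adj u) (sym u≡v) adj)) u'≢v' same
  ... | inj₁ (u≡u' , v≡v') = subst₂ Adj u≡u' v≡v' adj
  ... | inj₂ (u≡v' , _)    = contradiction (cong part u≡v') parts-differ

  module Transversal (r : Vec' k) (π : Vec' d) (r' : Fin k → Vec' k) (π' : Fin k → Vec' d)
    (agree : ∀ i → AgreeOutside r (r' i) i i) (edge : ∀ i → AxisEdge i r π (r' i) (π' i)) where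

    transversal : Fin k → Fin n
    transversal i = AxisEdge.v (edge i)

    rows-differ-at : ∀ {i j} → i ≢ j → r' i i ≢ r' j i
    rows-differ-at {i} {j} i≢j r'ᵢ≡r'ⱼ =
      x+a≢x (AxisEdge.a≢0 (edge i))
        (trans (sym (AxisEdge.row-step (edge i))) (trans r'ᵢ≡r'ⱼ (sym (agree j i i≢j i≢j))))

    rows-agree-outside : ∀ {i j} → AgreeOutside (r' i) (r' j) i j
    rows-agree-outside {i} {j} m m≢i m≢j = trans (sym (agree i m m≢i m≢i)) (agree j m m≢j m≢j)

    transversal-adjacent : IsLinearSidon φ → ∀ {i j} → i ≢ j →
      AdjH (r' i , π' i) (r' j , π' j) → Adj (transversal i) (transversal j)
    transversal-adjacent sidon {i} {j} i≢j adjH =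
      sidon-adjacent sidon D.a≢0 D.b≢0 D.adjacent
        (λ vᵢ≡vⱼ → i≢j (trans (sym Eᵢ.part-v) (trans (cong part vᵢ≡vⱼ) Eⱼ.part-v)))
        (λ pu≡pvⱼ → i≢j (trans (sym D.part-u) (trans pu≡pvⱼ Eⱼ.part-v)))
        same-offset
      where
      j≢i : j ≢ i
      j≢i j≡i = i≢j (sym j≡i)
      module D = DiagonalEdge (edge-across i≢j adjH rows-agree-outside (rows-differ-at i≢j)
                                (λ eq → rows-differ-at j≢i (sym eq)))
      module Eᵢ = AxisEdge (edge i)
      module Eⱼ = AxisEdge (edge j)
      a≡-aᵢ : D.a ≡ -F Eᵢ.a
      a≡-aᵢ = x≡[x+a]+b⇒b≡-a
        (trans (agree j i i≢j i≢j) (trans D.row-i (cong (_+F D.a) Eᵢ.row-step)))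
      b≡aⱼ : D.b ≡ Eⱼ.a
      b≡aⱼ = sym (∙-cancelˡ _ _ _
        (trans (sym Eⱼ.row-step) (trans D.row-j (cong (_+F D.b) (sym (agree i j j≢i j≢i))))))
      vᵢ vⱼ : Fin n
      vᵢ = transversal i
      vⱼ = transversal j
      same-offset : ((D.a · φ D.u) ⊕ (D.b · φ D.v)) ≋ ((D.a · φ vᵢ) ⊕ (D.b · φ vⱼ))
      same-offset m = begin
        (D.a *F φ D.u m) +F (D.b *F φ D.v m)
          ≡⟨ sym (D.offset m) ⟩
        π' j m +F (-F (π' i m))
          ≡⟨ sym ([z-x]-[y-x]≡z-y (π m) (π' i m) (π' j m)) ⟩
        (π' j m +F (-F (π m))) +F (-F (π' i m +F (-F (π m))))
          ≡⟨ cong₂ (λ s t → s +F (-F t)) (Eⱼ.offset m) (Eᵢ.offset m) ⟩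
        (Eⱼ.a *F φ vⱼ m) +F (-F (Eᵢ.a *F φ vᵢ m))
          ≡⟨ cong ((Eⱼ.a *F φ vⱼ m) +F_) (-‿distribˡ-* Eᵢ.a _) ⟩
        (Eⱼ.a *F φ vⱼ m) +F ((-F Eᵢ.a) *F φ vᵢ m)
          ≡⟨ +-comm _ _ ⟩
        ((-F Eᵢ.a) *F φ vᵢ m) +F (Eⱼ.a *F φ vⱼ m)
          ≡⟨ cong₂ (λ s t → (s *F φ vᵢ m) +F (t *F φ vⱼ m)) (sym a≡-aᵢ) (sym b≡aⱼ) ⟩
        (D.a *F φ vᵢ m) +F (D.b *F φ vⱼ m)
          ∎
        where open ≡-Reasoning

clique-bound : ∀ {q : ℕ} (F : FiniteField q) {n : ℕ} (G : Graph n) {k' : ℕ}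
  (part : Fin n → Fin (suc k')) (d : ℕ) (φ : Fin n → Construction.Vec' F d) →
  Construction.IsLinearSidon F φ → ¬ HasClique (Graph.Adj G) (suc k') →
  ∀ {N} (c : Fin N → Construction.H.VH F G (suc k') part d φ) →
  IsClique (Construction.H.AdjH F G (suc k') part d φ) N c → N ≤ suc k' * q ^ k'
clique-bound {q} F G {k'} part d φ sidon no-clique {N} c isClique = ≮⇒≥ too-large
  where
  open FiniteField F using (Carrier; _≟_)
  open EdgeFacts F G (suc k') part d φ
  open FieldFacts F using (x+a≢x)

  row : Fin N → Construction.Vec' F (suc k')
  row x = proj₁ (c x)

  HasPartner : Fin N → Fin (suc k') → Set
  HasPartner x i = ∃ λ y → DifferOnlyAt i (row x) (row y)

  hasPartner? : ∀ x i → Dec (HasPartner x i)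
  hasPartner? x i = any? (λ y → differOnlyAt? _≟_ i (row x) (row y))

  partner-≢ : ∀ {x y i} → DifferOnlyAt i (row x) (row y) → x ≢ y
  partner-≢ (_ , differ) refl = differ refl

  full⇒clique : ∀ x → (∀ i → HasPartner x i) → HasClique (Graph.Adj G) (suc k')
  full⇒clique x partner = transversal , λ i j i≢j →
    transversal-adjacent sidon i≢j
      (isClique (y i) (y j) λ yᵢ≡yⱼ → rows-differ-at i≢j (cong (λ z → row z i) yᵢ≡yⱼ))
    where
    y : Fin (suc k') → Fin N
    y i = proj₁ (partner i)
    agree : ∀ i → AgreeOutside (row x) (row (y i)) i i
    agree i = proj₁ (proj₂ (partner i))
    open Transversal (row x) (proj₂ (c x)) (λ i → row (y i)) (λ i → proj₂ (c (y i))) agree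
      (λ i → edge-along (isClique x (y i) (partner-≢ (proj₂ (partner i)))) (agree i))

  lonely : ¬ ∃ (λ x → ∀ i → HasPartner x i) → ∀ x → ∃ λ i → ¬ HasPartner x i
  lonely no-full x = ¬∀⟶∃¬ _ _ (hasPartner? x) (λ partner → no-full (x , partner))

  lonely-collision : ¬ ∃ (λ x → ∀ i → HasPartner x i) → ¬ suc k' * q ^ k' < N
  lonely-collision no-full lt = collision-impossible (punctured-pigeonhole ι row dir lt)
    where
    ι : Carrier ↣ Fin q
    ι = ↔⇒↣ (↔-sym (FiniteField.enum F))
    dir : Fin N → Fin (suc k')
    dir x = proj₁ (lonely no-full x)
    collision-impossible : ¬ ∃₂ λ x y → x ≢ y × AgreeOutside (row x) (row y) (dir x) (dir x)
    collision-impossible (x , y , x≢y , agree) = proj₂ (lonely no-full x) (y , agree , differ)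
      where
      module E = AxisEdge (edge-along (isClique x y x≢y) agree)
      differ : row x (dir x) ≢ row y (dir x)
      differ eq = x+a≢x E.a≢0 (trans (sym E.row-step) (sym eq))

  too-large : ¬ suc k' * q ^ k' < N
  too-large lt with any? (λ x → all? (hasPartner? x))
  ... | yes (x , partner) = no-clique (full⇒clique x partner)
  ... | no no-full        = lonely-collision no-full lt

-- Independence of the parts, the prime-power condition on q and the value of d are not needed:
-- (H3) already puts u and v into different parts.
lemma4 : ∀ {n : ℕ} (G : Graph n) (k : ℕ) → 1 ≤ k →
    (part : Fin n → Fin k) → IsIndependentPartition G k part →
    (q : ℕ) → IsPrimePower q → (F : FiniteField q) →
    (d : ℕ) → IsDimension n q d →
    (φ : Fin n → Construction.Vec' F d) → Construction.IsLinearSidon F φ →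
    ¬ HasClique (Graph.Adj G) k →
    ¬ HasClique (Construction.H.AdjH F G k part d φ) (k * q ^ (k ∸ 1) + 1)
lemma4 G (suc k') _ part _ q _ F d _ φ sidon no-clique (c , isClique) =
  <⇒≱ (m<m+n _ z<s) (clique-bound F G part d φ sidon no-clique c isClique)
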